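{- Let $A,B$ be positive integers such that $(A,B)$ is a polynomial pair. Then $A_\infty B_\infty\le 9$. If moreover $A_\infty\ge 5$, then $B_\infty=1$.
   Context: For a positive integer $A$ with decimal representation $A=\sum_{i=0}^{a} a_i 10^i$ (digits $a_i\in\{0,\dots,9\}$, $a_a\neq0$), let $P(A,x)=\sum_{i=0}^a a_i x^i$, and let $A_\infty=\max_i a_i$ be the largest decimal digit of $A$. A pair $(A,B)$ of positive integers is a polynomial pair if $P(A,x)P(B,x)=P(A\times B,x)$. -}

module Defs where

open import Data.Nat using (ℕ; zero; suc; _+_; _*_; _⊔_)
open import Data.Nat.DivMod using (_/_; _%_)
open import Data.List using (List; []; _∷_; foldr)
open import Relation.Binary.PropositionalEquality using (_≡_)

-- little-endian decimal digits, with fuel (fuel ≥ n suffices, since n/10 < n)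
digitsFuel : ℕ → ℕ → List ℕ
digitsFuel zero    n       = []
digitsFuel (suc f) zero    = []
digitsFuel (suc f) (suc n) = (suc n % 10) ∷ digitsFuel f (suc n / 10)

-- decimal digits a_0, a_1, ..., a_a of A (a_a ≠ 0 for A > 0); empty for 0
digits : ℕ → List ℕ
digits n = digitsFuel n n

coeff : List ℕ → ℕ → ℕ
coeff []       i       = 0
coeff (c ∷ cs) zero    = c
coeff (c ∷ cs) (suc i) = coeff cs i

scale : ℕ → List ℕ → List ℕ
scale a []       = []
scale a (b ∷ bs) = a * b ∷ scale a bs

addP : List ℕ → List ℕ → List ℕ
addP []       ys       = ys
addP xs       []       = xs
addP (x ∷ xs) (y ∷ ys) = x + y ∷ addP xs ys

mulP : List ℕ → List ℕ → List ℕ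
mulP []       q = []
mulP (a ∷ as) q = addP (scale a q) (0 ∷ mulP as q)

P : ℕ → List ℕ
P A = digits A

_≈P_ : List ℕ → List ℕ → Set
p ≈P q = (i : ℕ) → coeff p i ≡ coeff q i

PolynomialPair : ℕ → ℕ → Set
PolynomialPair A B = mulP (P A) (P B) ≈P P (A * B)

maxDigit : ℕ → ℕ
maxDigit A = foldr _⊔_ 0 (digits A)

module Submission where

-- Coefficients of a product of polynomials with natural
-- coefficients dominate products of coefficients:
--   a_i b_j ≤ [x^(i+j)] P(A,x) P(B,x).
-- For a polynomial pair the right-hand side is a decimal digit of A × B,
-- hence at most 9.  Choosing i, j where the maximal digits A_∞, B_∞ are
-- attained gives A_∞ B_∞ ≤ 9.  Since B > 0 has a nonzero digit, B_∞ ≥ 1,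
-- and then A_∞ ≥ 5 forces B_∞ = 1 by elementary arithmetic (5 · 2 > 9).

open import Defs
open import Data.Nat using (ℕ; zero; suc; _+_; _*_; _⊔_; _≤_; _≥_; _<_; z≤n; s≤s; NonZero; >-nonZero⁻¹)
open import Data.Nat.Properties
open import Data.Nat.DivMod using (_/_; _%_; m%n<n; m/n<m; m≡m%n+[m/n]*n)
open import Data.List using (List; []; _∷_; foldr)
open import Data.Product using (∃; _×_; _,_)
open import Data.Sum using (inj₁; inj₂)
open import Data.Empty using (⊥-elim)
open import Relation.Binary.PropositionalEquality
  using (_≡_; refl; sym; trans; cong₂; subst; module ≡-Reasoning)

coeff-addP : ∀ xs ys k → coeff (addP xs ys) k ≡ coeff xs k + coeff ys k
coeff-addP []       ys       k       = refl
coeff-addP (x ∷ xs) []       k       = sym (+-identityʳ _)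
coeff-addP (x ∷ xs) (y ∷ ys) zero    = refl
coeff-addP (x ∷ xs) (y ∷ ys) (suc k) = coeff-addP xs ys k

coeff-scale : ∀ a q k → coeff (scale a q) k ≡ a * coeff q k
coeff-scale a []      k       = sym (*-zeroʳ a)
coeff-scale a (b ∷ q) zero    = refl
coeff-scale a (b ∷ q) (suc k) = coeff-scale a q k

-- With natural coefficients there is no cancellation: the product of the
-- i-th coefficient of p and the j-th of q is at most the (i+j)-th of pq.
coeff-mulP-≥ : ∀ p q i j → coeff p i * coeff q j ≤ coeff (mulP p q) (i + j)
coeff-mulP-≥ []       q i       j = z≤n
coeff-mulP-≥ (a ∷ as) q zero    j
  rewrite coeff-addP (scale a q) (0 ∷ mulP as q) j | coeff-scale a q j
  = m≤m+n (a * coeff q j) _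
coeff-mulP-≥ (a ∷ as) q (suc i) j
  rewrite coeff-addP (scale a q) (0 ∷ mulP as q) (suc (i + j))
  = ≤-trans (coeff-mulP-≥ as q i j) (m≤n+m _ _)

coeff-≤-maximum : ∀ xs k → coeff xs k ≤ foldr _⊔_ 0 xs
coeff-≤-maximum []       k       = z≤n
coeff-≤-maximum (x ∷ xs) zero    = m≤m⊔n x _
coeff-≤-maximum (x ∷ xs) (suc k) = ≤-trans (coeff-≤-maximum xs k) (m≤n⊔m x _)

maximum-attained : ∀ xs → ∃ λ i → coeff xs i ≡ foldr _⊔_ 0 xs
maximum-attained []       = 0 , refl
maximum-attained (x ∷ xs) with ⊔-sel x (foldr _⊔_ 0 xs)
... | inj₁ x⊔m≡x = 0 , sym x⊔m≡x
... | inj₂ x⊔m≡m with maximum-attained xs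
...   | i , xᵢ≡m = suc i , trans xᵢ≡m (sym x⊔m≡m)

digit-≤-9 : ∀ f n k → coeff (digitsFuel f n) k ≤ 9
digit-≤-9 zero    n       k       = z≤n
digit-≤-9 (suc f) zero    k       = z≤n
digit-≤-9 (suc f) (suc n) zero    = ≤-pred (m%n<n (suc n) 10)
digit-≤-9 (suc f) (suc n) (suc k) = digit-≤-9 f (suc n / 10) k

quotient-positive : ∀ n → 0 < n → n % 10 ≡ 0 → 0 < n / 10
quotient-positive n n>0 n%10≡0 = n≢0⇒n>0 λ n/10≡0 → <⇒≢ n>0 (sym (begin
    n                      ≡⟨ m≡m%n+[m/n]*n n 10 ⟩
    n % 10 + n / 10 * 10   ≡⟨ cong₂ (λ r q → r + q * 10) n%10≡0 n/10≡0 ⟩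
    0                      ∎))
  where open ≡-Reasoning

-- A positive number has a positive digit, provided the fuel suffices;
-- if the last digit is 0 the quotient is positive and we recurse on it.
positive-digit : ∀ f n → n ≤ f → 0 < n → ∃ λ k → 0 < coeff (digitsFuel f n) k
positive-digit (suc f) (suc m) (s≤s m≤f) m+1>0 with suc m % 10 in last-digit
... | suc d = 0 , s≤s z≤n
... | zero with positive-digit f (suc m / 10) quotient≤f
                 (quotient-positive (suc m) m+1>0 last-digit)
  where
  quotient≤f : suc m / 10 ≤ f
  quotient≤f = ≤-trans (≤-pred (m/n<m (suc m) 10 (s≤s (s≤s z≤n)))) m≤f
...   | k , digit>0 = suc k , digit>0

maxDigit-positive : ∀ n → NonZero n → 1 ≤ maxDigit n
maxDigit-positive n nz with positive-digit n n ≤-refl (>-nonZero⁻¹ n {{nz}})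
... | k , digit>0 = ≤-trans digit>0 (coeff-≤-maximum (digits n) k)

-- First claim: for a polynomial pair, A_∞ B_∞ is bounded by a digit of A × B.
maxDigit-product-≤-9 : ∀ A B → PolynomialPair A B → maxDigit A * maxDigit B ≤ 9
maxDigit-product-≤-9 A B pair
  with maximum-attained (digits A) | maximum-attained (digits B)
... | i , aᵢ≡A∞ | j , bⱼ≡B∞ =
  subst (_≤ 9) (cong₂ _*_ aᵢ≡A∞ bⱼ≡B∞) (begin
    coeff (P A) i * coeff (P B) j   ≤⟨ coeff-mulP-≥ (P A) (P B) i j ⟩
    coeff (mulP (P A) (P B)) (i + j) ≡⟨ pair (i + j) ⟩
    coeff (P (A * B)) (i + j)        ≤⟨ digit-≤-9 (A * B) (A * B) (i + j) ⟩
    9                                ∎)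
  where open ≤-Reasoning

large-factor-forces-one : ∀ a b → 5 ≤ a → 1 ≤ b → a * b ≤ 9 → b ≡ 1
large-factor-forces-one a zero          _   ()  _
large-factor-forces-one a (suc zero)    _   _   _    = refl
large-factor-forces-one a (suc (suc b)) a≥5 _   ab≤9 =
  ⊥-elim (<⇒≱ (n<1+n 9) (≤-trans (*-mono-≤ a≥5 (s≤s (s≤s (z≤n {b})))) ab≤9))

proposition5 : (A B : ℕ) → NonZero A → NonZero B → PolynomialPair A B →
    (maxDigit A * maxDigit B ≤ 9) × (maxDigit A ≥ 5 → maxDigit B ≡ 1)
proposition5 A B _ nzB pair = product≤9 , λ A∞≥5 →
  large-factor-forces-one (maxDigit A) (maxDigit B) A∞≥5
    (maxDigit-positive B nzB) product≤9
  where
  product≤9 : maxDigit A * maxDigit B ≤ 9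
  product≤9 = maxDigit-product-≤-9 A B pair
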